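{- Let $H$ be a hypergraph. An edge $e\in E(H)$ is dispensable in $H$ if and only if there is an edge $e'\in E([H]_2)$ with $e'\subseteq e$ such that $e'$ is dispensable in $[H]_2$.
   Context: All hypergraphs $H=(V,E)$ are finite ($E$ a set of nonempty subsets of $V$), simple ($|e|\ge2$ for all edges, no edge properly contained in another) and connected. The $2$-section $[H]_2$ is the graph on $V$ whose edges are the pairs $\{x,y\}$, $x\ne y$, contained in some edge of $H$. In a hypergraph (or graph) $G$, $N[v]$ is $v$ together with all vertices sharing an edge of $G$ with $v$. An edge $e$ of $G$ is dispensable in $G$ if there are a vertex $z$ and distinct $x,y\in e$ with (1) $N[x]\cap N[y]\subsetneq N[x]\cap N[z]$ or $N[x]\subsetneq N[z]\subsetneq N[y]$, and (2) $N[x]\cap N[y]\subsetneq N[y]\cap N[z]$ or $N[y]\subsetneq N[z]\subsetneq N[x]$, all neighborhoods taken in $G$. -}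

module Defs where

open import Level using (0ℓ)
open import Data.Nat using (ℕ; _≤_)
open import Data.Fin using (Fin)
open import Data.Fin.Subset as S using (Subset; ⁅_⁆; ∣_∣)
open import Data.List using (List)
open import Data.List.Membership.Propositional as L using ()
open import Data.Product using (Σ; ∃; ∃-syntax; _×_)
open import Data.Sum using (_⊎_)
open import Relation.Nullary using (¬_)
open import Relation.Unary using (Pred; _∩_) renaming (_⊆_ to _⊆ₚ_)
open import Relation.Binary.PropositionalEquality using (_≡_; _≢_)
open import Relation.Binary.Construct.Closure.ReflexiveTransitive using (Star)

-- Vertex set is Fin n; an edge is a subset of Fin n.
-- A family of edges (possibly infinite a priori, but Subset n is finite)
EdgeFamily : ℕ → Set₁
EdgeFamily n = Pred (Subset n) 0ℓ

edgesOf : ∀ {n} → List (Subset n) → EdgeFamily n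
edgesOf H e = e L.∈ H

Adj : ∀ {n} → EdgeFamily n → Fin n → Fin n → Set
Adj G x y = ∃[ e ] (G e × x S.∈ e × y S.∈ e)

N[_]_ : ∀ {n} → Fin n → EdgeFamily n → Pred (Fin n) 0ℓ
(N[ v ] G) u = u ≡ v ⊎ Adj G v u

_⊊_ : ∀ {n} → Pred (Fin n) 0ℓ → Pred (Fin n) 0ℓ → Set
A ⊊ B = A ⊆ₚ B × ∃[ x ] (B x × ¬ A x)

-- H is a (finite) simple connected hypergraph on Fin n
record IsHypergraph {n : ℕ} (H : List (Subset n)) : Set where
  field
    edge-size  : ∀ {e} → e L.∈ H → 2 ≤ ∣ e ∣
    sperner    : ∀ {e f} → e L.∈ H → f L.∈ H → ¬ (e S.⊂ f)
    connected  : ∀ x y → Star (Adj (edgesOf H)) x y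

twoSection : ∀ {n} → List (Subset n) → EdgeFamily n
twoSection H s = ∃[ x ] ∃[ y ] (x ≢ y × s ≡ ⁅ x ⁆ S.∪ ⁅ y ⁆ × Adj (edgesOf H) x y)

Dispensable : ∀ {n} → EdgeFamily n → Subset n → Set
Dispensable G e = ∃[ z ] ∃[ x ] ∃[ y ] (x S.∈ e × y S.∈ e × x ≢ y ×
    (((N[ x ] G) ∩ (N[ y ] G)) ⊊ ((N[ x ] G) ∩ (N[ z ] G))
      ⊎ ((N[ x ] G) ⊊ (N[ z ] G) × (N[ z ] G) ⊊ (N[ y ] G))) ×
    (((N[ x ] G) ∩ (N[ y ] G)) ⊊ ((N[ y ] G) ∩ (N[ z ] G))
      ⊎ ((N[ y ] G) ⊊ (N[ z ] G) × (N[ z ] G) ⊊ (N[ x ] G))))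

-- Dispensability of an edge depends only on the closed neighbourhoods of its vertices and is
-- witnessed by a pair x ≠ y inside the edge.  Closed neighbourhoods in H and in [H]₂ coincide, and
-- the pairs inside an edge of H are exactly the edges of [H]₂ it contains; so a witnessing pair for
-- e in H is one for {x, y} in [H]₂ and conversely.
module Submission where

open import Defs
open import Level using (0ℓ)
open import Data.Nat using (ℕ)
open import Data.Fin using (Fin; _≟_)
open import Data.Fin.Subset as S using (Subset; _⊆_; ⁅_⁆; _∪_)
open import Data.Fin.Subset.Properties using (x∈⁅x⁆; x∈⁅y⁆⇒x≡y; x∈p∪q⁻; x∈p∪q⁺)
open import Data.List using (List)
open import Data.List.Membership.Propositional using (_∈_)
open import Data.Product using (∃-syntax; _×_; _,_)
open import Data.Sum using (_⊎_; inj₁; inj₂)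
open import Function.Bundles using (_⇔_; mk⇔)
open import Relation.Nullary using (yes; no; contradiction)
open import Relation.Binary.PropositionalEquality using (_≡_; _≢_; refl; sym)
open import Relation.Unary using (Pred; _∩_; _≐_)
open import Relation.Unary.Properties using (≐-sym)

private
  variable
    n : ℕ
    A A′ B B′ : Pred (Fin n) 0ℓ

⊊-resp-≐ : A ≐ A′ → B ≐ B′ → A ⊊ B → A′ ⊊ B′
⊊-resp-≐ (_ , A′⊆A) (B⊆B′ , _) (A⊆B , w , Bw , ¬Aw) =
  (λ A′u → B⊆B′ (A⊆B (A′⊆A A′u))) , w , B⊆B′ Bw , (λ A′w → ¬Aw (A′⊆A A′w))

∩-resp-≐ : A ≐ A′ → B ≐ B′ → (A ∩ B) ≐ (A′ ∩ B′)
∩-resp-≐ (A⊆A′ , A′⊆A) (B⊆B′ , B′⊆B) =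
  (λ (Au , Bu) → A⊆A′ Au , B⊆B′ Bu) , (λ (A′u , B′u) → A′⊆A A′u , B′⊆B B′u)

-- Dispensable G e unfolds definitionally to ∃ z x y (x ∈ e × y ∈ e × x ≢ y × PairDispensable (N[_] G) z x y).
PairDispensable : (Fin n → Pred (Fin n) 0ℓ) → Fin n → Fin n → Fin n → Set
PairDispensable N z x y =
  ((N x ∩ N y) ⊊ (N x ∩ N z) ⊎ (N x ⊊ N z × N z ⊊ N y)) ×
  ((N x ∩ N y) ⊊ (N y ∩ N z) ⊎ (N y ⊊ N z × N z ⊊ N x))

pairDispensable-resp-≐ : {N N′ : Fin n → Pred (Fin n) 0ℓ} → (∀ v → N v ≐ N′ v) →
  ∀ {z x y} → PairDispensable N z x y → PairDispensable N′ z x y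
pairDispensable-resp-≐ {N = N} {N′} N≐N′ {z} {x} {y} (c₁ , c₂) = first c₁ , second c₂
  where
  first : (N x ∩ N y) ⊊ (N x ∩ N z) ⊎ (N x ⊊ N z × N z ⊊ N y) →
          (N′ x ∩ N′ y) ⊊ (N′ x ∩ N′ z) ⊎ (N′ x ⊊ N′ z × N′ z ⊊ N′ y)
  first (inj₁ p)       = inj₁ (⊊-resp-≐ (∩-resp-≐ (N≐N′ x) (N≐N′ y)) (∩-resp-≐ (N≐N′ x) (N≐N′ z)) p)
  first (inj₂ (p , q)) = inj₂ (⊊-resp-≐ (N≐N′ x) (N≐N′ z) p , ⊊-resp-≐ (N≐N′ z) (N≐N′ y) q)

  second : (N x ∩ N y) ⊊ (N y ∩ N z) ⊎ (N y ⊊ N z × N z ⊊ N x) →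
           (N′ x ∩ N′ y) ⊊ (N′ y ∩ N′ z) ⊎ (N′ y ⊊ N′ z × N′ z ⊊ N′ x)
  second (inj₁ p)       = inj₁ (⊊-resp-≐ (∩-resp-≐ (N≐N′ x) (N≐N′ y)) (∩-resp-≐ (N≐N′ y) (N≐N′ z)) p)
  second (inj₂ (p , q)) = inj₂ (⊊-resp-≐ (N≐N′ y) (N≐N′ z) p , ⊊-resp-≐ (N≐N′ z) (N≐N′ x) q)

dispensable-resp-≐ : {G G′ : EdgeFamily n} → (∀ v → (N[ v ] G) ≐ (N[ v ] G′)) →
  ∀ {e} → Dispensable G e → Dispensable G′ e
dispensable-resp-≐ N≐N′ (z , x , y , x∈e , y∈e , x≢y , d) =
  z , x , y , x∈e , y∈e , x≢y , pairDispensable-resp-≐ N≐N′ d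

dispensable-mono : {G : EdgeFamily n} {e f : Subset n} → e ⊆ f → Dispensable G e → Dispensable G f
dispensable-mono e⊆f (z , x , y , x∈e , y∈e , x≢y , d) = z , x , y , e⊆f x∈e , e⊆f y∈e , x≢y , d

x∈⁅x,y⁆ : (x y : Fin n) → x S.∈ ⁅ x ⁆ ∪ ⁅ y ⁆
x∈⁅x,y⁆ x y = x∈p∪q⁺ (inj₁ (x∈⁅x⁆ x))

y∈⁅x,y⁆ : (x y : Fin n) → y S.∈ ⁅ x ⁆ ∪ ⁅ y ⁆
y∈⁅x,y⁆ x y = x∈p∪q⁺ (inj₂ (x∈⁅x⁆ y))

∈⁅x,y⁆⁻ : {w x y : Fin n} → w S.∈ ⁅ x ⁆ ∪ ⁅ y ⁆ → w ≡ x ⊎ w ≡ y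
∈⁅x,y⁆⁻ {x = x} {y} w∈ with x∈p∪q⁻ ⁅ x ⁆ ⁅ y ⁆ w∈
... | inj₁ w∈⁅x⁆ = inj₁ (x∈⁅y⁆⇒x≡y x w∈⁅x⁆)
... | inj₂ w∈⁅y⁆ = inj₂ (x∈⁅y⁆⇒x≡y y w∈⁅y⁆)

⁅x,y⁆⊆ : {x y : Fin n} {e : Subset n} → x S.∈ e → y S.∈ e → ⁅ x ⁆ ∪ ⁅ y ⁆ ⊆ e
⁅x,y⁆⊆ x∈e y∈e w∈ with ∈⁅x,y⁆⁻ w∈
... | inj₁ refl = x∈e
... | inj₂ refl = y∈e

module _ (H : List (Subset n)) where

  Adj-sym : ∀ {x y} → Adj (edgesOf H) x y → Adj (edgesOf H) y x
  Adj-sym (e , e∈H , x∈e , y∈e) = e , e∈H , y∈e , x∈e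

  pair∈twoSection : ∀ {x y} → x ≢ y → Adj (edgesOf H) x y → twoSection H (⁅ x ⁆ ∪ ⁅ y ⁆)
  pair∈twoSection x≢y adj = _ , _ , x≢y , refl , adj

  N[]-twoSection : ∀ v → (N[ v ] edgesOf H) ≐ (N[ v ] twoSection H)
  N[]-twoSection v = to , from
    where
    to : ∀ {u} → (N[ v ] edgesOf H) u → (N[ v ] twoSection H) u
    to (inj₁ u≡v) = inj₁ u≡v
    to {u} (inj₂ adj@(_ , _ , v∈e , u∈e)) with u ≟ v
    ... | yes u≡v = inj₁ u≡v
    ... | no u≢v  = inj₂ (_ , pair∈twoSection (λ v≡u → u≢v (sym v≡u)) adj , x∈⁅x,y⁆ v u , y∈⁅x,y⁆ v u)

    from : ∀ {u} → (N[ v ] twoSection H) u → (N[ v ] edgesOf H) u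
    from (inj₁ u≡v) = inj₁ u≡v
    from {u} (inj₂ (_ , (x , y , _ , refl , adj) , v∈ , u∈)) with u ≟ v
    ... | yes u≡v = inj₁ u≡v
    ... | no u≢v with ∈⁅x,y⁆⁻ v∈ | ∈⁅x,y⁆⁻ u∈
    ... | inj₁ refl | inj₁ refl = contradiction refl u≢v
    ... | inj₁ refl | inj₂ refl = inj₂ adj
    ... | inj₂ refl | inj₁ refl = inj₂ (Adj-sym adj)
    ... | inj₂ refl | inj₂ refl = contradiction refl u≢v

lemma3p4 : {n : ℕ} (H : List (Subset n)) → IsHypergraph H →
    (e : Subset n) → e ∈ H →
    Dispensable (edgesOf H) e ⇔ (∃[ e′ ] (twoSection H e′ × e′ ⊆ e × Dispensable (twoSection H) e′))
lemma3p4 H _ e e∈H = mk⇔ to from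
  where
  to : Dispensable (edgesOf H) e → ∃[ e′ ] (twoSection H e′ × e′ ⊆ e × Dispensable (twoSection H) e′)
  to (z , x , y , x∈e , y∈e , x≢y , d) =
    ⁅ x ⁆ ∪ ⁅ y ⁆ ,
    pair∈twoSection H x≢y (e , e∈H , x∈e , y∈e) ,
    ⁅x,y⁆⊆ x∈e y∈e ,
    dispensable-resp-≐ (N[]-twoSection H) (z , x , y , x∈⁅x,y⁆ x y , y∈⁅x,y⁆ x y , x≢y , d)

  from : ∃[ e′ ] (twoSection H e′ × e′ ⊆ e × Dispensable (twoSection H) e′) → Dispensable (edgesOf H) e
  from (e′ , _ , e′⊆e , d) =
    dispensable-resp-≐ (λ v → ≐-sym (N[]-twoSection H v)) (dispensable-mono e′⊆e d)
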